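{- For $m,n\ge2$, $|\{u\in\mathsf{Rec}^{\star}(D_{m,n}) : u\text{ is minanz}\}|=\binom{m+n-4}{m-2}$.
   Context: $D_{m,n}$ is the directed graph with vertices $v_0,\ldots,v_{m+n-1}$ and an arc $(v_i,v_j)$ whenever one of $i,j$ lies in $\{0,\ldots,m-1\}$ and the other in $\{m,\ldots,m+n-1\}$; $v_0$ is the sink. Configurations $x\in\mathbb{N}_0^{m+n-1}$; out-degree $d_i=n$ for $1\le i\le m-1$, $d_i=m$ for $m\le i\le m+n-1$; an unstable vertex ($x_i\ge d_i$) topples by losing $d_i$ grains and giving one grain to each non-sink out-neighbour; stable means all $x_i<d_i$; $\sigma(x)$ is the stable configuration reached by repeated toppling. A stable $u$ is recurrent if $u=\sigma(x)$ for some $x$ with $x_i\ge d_i$ for all $i$. $\mathsf{Rec}^{\star}(D_{m,n})$ is the set of recurrent $u$ with $u_1\le\cdots\le u_{m-1}$ and $u_m\le\cdots\le u_{m+n-1}$. $\mathsf{level}(u)=u_1+\cdots+u_{m+n-1}-n(m-1)$; $u$ is minimal if $\mathsf{level}(u)=0$ (the least possible value); $u$ is almost non-zero if $u_i>0$ for all $i\in\{1,\ldots,m+n-1\}\setminus\{m\}$; minanz means minimal and almost non-zero. -}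

module Defs where

open import Data.Nat using (ℕ; zero; suc; _+_; _*_; _∸_; _≤_; _<_; _<ᵇ_)
open import Data.Bool using (Bool; true; false; if_then_else_; _xor_)
open import Data.Fin using (Fin; toℕ; _≟_)
open import Data.Vec using (Vec; lookup; tabulate)
open import Data.Vec using () renaming (sum to vsum)
open import Data.Integer using (ℤ; +_; _-_)
open import Data.Product using (Σ; ∃; _×_)
open import Relation.Nullary using (¬_; yes; no)
open import Relation.Binary.PropositionalEquality using (_≡_)
open import Relation.Binary.Construct.Closure.ReflexiveTransitive using (Star)

-- The sandpile model on D_{m,n}.  Vertices v_0 .. v_{m+n-1}, sink v_0.
-- A configuration is a vector indexed by Fin (m + n ∸ 1); position j
-- stands for the non-sink vertex v_{j+1}.
module Sandpile (m n : ℕ) where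

  N : ℕ
  N = m + n ∸ 1

  Config : Set
  Config = Vec ℕ N

  -- vertex v_{j+1} lies in the first part {v_0,…,v_{m-1}}
  inA : Fin N → Bool
  inA j = suc (toℕ j) <ᵇ m

  deg : Fin N → ℕ
  deg j = if inA j then n else m

  -- toppling vertex v_{j+1}: it loses d_{j+1} grains, every non-sink
  -- out-neighbour (= every non-sink vertex of the other part) gains one
  topple : Config → Fin N → Config
  topple x j = tabulate λ k → f k
    where
    f : Fin N → ℕ
    f k with k ≟ j
    ... | yes _ = lookup x k ∸ deg j
    ... | no _  = if inA k xor inA j then suc (lookup x k) else lookup x k

  Step : Config → Config → Set
  Step x y = Σ (Fin N) λ j → (deg j ≤ lookup x j) × (y ≡ topple x j)

  Stable : Config → Set
  Stable u = ∀ j → lookup u j < deg j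

  Stabilises : Config → Config → Set
  Stabilises x u = Star Step x u × Stable u

  Recurrent : Config → Set
  Recurrent u = Stable u × ∃ λ x → (∀ j → deg j ≤ lookup x j) × Stabilises x u

  Sorted : Config → Set
  Sorted u = ∀ j k → toℕ j ≤ toℕ k → inA j ≡ inA k → lookup u j ≤ lookup u k

  RecStar : Config → Set
  RecStar u = Recurrent u × Sorted u

  level : Config → ℤ
  level u = + vsum u - + (n * (m ∸ 1))

  Minimal : Config → Set
  Minimal u = level u ≡ + 0

  AlmostNonZero : Config → Set
  AlmostNonZero u = ∀ j → ¬ (suc (toℕ j) ≡ m) → 0 < lookup u j

  Minanz : Config → Set
  Minanz u = Minimal u × AlmostNonZero u

module Submission where

-- Write m = m' + 1 and split the non-sink vertices into A = {v_1..v_{m-1}} (m' vertices,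
-- on the sink's side) and B = {v_m..v_{m+n-1}} (n vertices); a configuration is a ++ b.
--  * Counting over Fin k, and the enumeration of weakly increasing vectors with entries
--    in [lo, hi), whose number follows Pascal's rule.
--  * Dhar's criterion: a stable u is recurrent iff it is FSC-free, i.e. no nonempty vertex
--    set F (a forbidden subconfiguration) has every member with fewer grains than
--    neighbours in F.  Necessity: such an F propagates backwards along topplings, and
--    cannot exist when every x_k ≥ d_k.  Sufficiency: the burning algorithm topples every
--    vertex once per round, each round taking one grain from B, which leads from u + d
--    back to u.
--  * For sorted a, b this becomes the cross condition (a_i > j or b_j > i), which forces
--    b ≥ a*, the conjugate a*_j = #{i : a_i ≤ j}, and holds for (a, a*).  Since
--    Σ a + Σ a* = n·m', minimality (n·m' grains) forces b = a*; almost non-zero then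
--    forces a_0 = 1.  So the configurations counted are (1 ∷ t, (1 ∷ t)*) with t of
--    length m - 2 weakly increasing in [1, n), and there are C(m+n-4, m-2) of those.

open import Defs
open import Data.Nat using (ℕ; zero; suc; _+_; _*_; _∸_; _≤_; _<_; _≤ᵇ_; _<ᵇ_; z≤n; s≤s; s≤s⁻¹)
open import Data.Nat.Properties hiding (_≟_)
open import Data.Nat.Combinatorics using (_C_; nCk+nC[k+1]≡[n+1]C[k+1]; nCn≡1)
open import Data.Bool using (Bool; true; false; not; _∧_; _xor_; if_then_else_)
open import Data.Bool.Properties using (T-≡; ∧-zeroʳ; ∧-identityʳ; ∧-inverseʳ; ∧-idem)
open import Data.Fin using (Fin; zero; suc; toℕ; _↑ˡ_; _↑ʳ_; _≟_; splitAt)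
import Data.Fin as Fin
open import Data.Fin.Properties using (any?; toℕ<n; toℕ-↑ˡ; toℕ-↑ʳ; splitAt-↑ˡ; splitAt-↑ʳ; splitAt⁻¹-↑ˡ; splitAt⁻¹-↑ʳ)
open import Data.Vec using (Vec; []; _∷_; lookup; tabulate; _++_)
import Data.Vec as Vec
import Data.Vec.Properties as Vec
open import Data.Vec.Properties using (∷-injectiveʳ; lookup∘tabulate; tabulate∘lookup; tabulate-cong; lookup-++ˡ; lookup-++ʳ)
open import Data.List using (List; []; _∷_; length)
import Data.List as List
open import Data.List.Properties using (length-map; length-++; ++-identityʳ)
open import Data.List.Membership.Propositional using (_∈_)
open import Data.List.Membership.Propositional.Properties using (∈-map⁺; ∈-map⁻; ∈-++⁺ˡ; ∈-++⁺ʳ; ∈-++⁻)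
open import Data.List.Relation.Unary.Any using (here)
open import Data.List.Relation.Unary.Unique.Propositional using (Unique)
import Data.List.Relation.Unary.Unique.Propositional.Properties as Unique
open import Data.List.Relation.Unary.AllPairs using ([]; _∷_)
open import Data.List.Relation.Unary.All using ([])
open import Data.Product using (Σ; ∃; _×_; _,_; proj₁; proj₂)
open import Data.Sum using (_⊎_; inj₁; inj₂; [_,_]′)
open import Data.Empty using (⊥-elim)
open import Relation.Nullary using (¬_; yes; no; does; _×-dec_)
open import Relation.Binary.Construct.Closure.ReflexiveTransitive using (Star; ε; _◅_; _◅◅_)
open import Function using (_∘_; case_of_)
open import Function.Bundles using (Equivalence; _⇔_; mk⇔)
import Data.Integer.Properties as ℤ
import Data.Integer as ℤ
open import Relation.Binary.PropositionalEquality
open import Algebra.Properties.CommutativeMonoid.Sum +-0-commutativeMonoid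
  using (sum; sum-cong-≗; ∑-distrib-+; ∑-comm)

<ᵇ-true : ∀ {a b} → a < b → (a <ᵇ b) ≡ true
<ᵇ-true a<b = Equivalence.to T-≡ (<⇒<ᵇ a<b)

<ᵇ-false : ∀ {a b} → b ≤ a → (a <ᵇ b) ≡ false
<ᵇ-false {a} {b} b≤a with a <ᵇ b in a<ᵇb
... | true  = ⊥-elim (<⇒≱ (<ᵇ⇒< a b (Equivalence.from T-≡ a<ᵇb)) b≤a)
... | false = refl

≤ᵇ-complete : ∀ {a b} → a ≤ b → (a ≤ᵇ b) ≡ true
≤ᵇ-complete a≤b = Equivalence.to T-≡ (≤⇒≤ᵇ a≤b)

≤ᵇ-sound : ∀ {a b} → (a ≤ᵇ b) ≡ true → a ≤ b
≤ᵇ-sound {a} {b} e = ≤ᵇ⇒≤ a b (Equivalence.from T-≡ e)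

∧-trueˡ : ∀ {a b} → a ∧ b ≡ true → a ≡ true
∧-trueˡ {true} _ = refl

∧-trueʳ : ∀ {a b} → a ∧ b ≡ true → b ≡ true
∧-trueʳ {true} b≡true = b≡true

not-true : ∀ {b} → not b ≡ true → b ≡ false
not-true {false} _ = refl

indicator : Bool → ℕ
indicator true  = 1
indicator false = 0

count : ∀ {k} → (Fin k → Bool) → ℕ
count P = sum (λ i → indicator (P i))

sum-const : ∀ {k} c → sum {k} (λ _ → c) ≡ k * c
sum-const {zero}  c = refl
sum-const {suc k} c = cong (c +_) (sum-const {k} c)

lookup-ext : ∀ {k} {u v : Vec ℕ k} → (∀ i → lookup u i ≡ lookup v i) → u ≡ v
lookup-ext {u = u} {v} u≗v = trans (sym (tabulate∘lookup u)) (trans (tabulate-cong u≗v) (tabulate∘lookup v))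

sum-vec : ∀ {k} (v : Vec ℕ k) → Vec.sum v ≡ sum (lookup v)
sum-vec []      = refl
sum-vec (x ∷ v) = cong (x +_) (sum-vec v)

sum-vec-++ : ∀ {k l} (a : Vec ℕ k) (b : Vec ℕ l) → Vec.sum (a ++ b) ≡ sum (lookup a) + sum (lookup b)
sum-vec-++ a b = trans (Vec.sum-++ a) (cong₂ _+_ (sum-vec a) (sum-vec b))

sum-split : ∀ {a b} (f : Fin (a + b) → ℕ) →
            sum f ≡ sum (λ i → f (i ↑ˡ b)) + sum (λ j → f (a ↑ʳ j))
sum-split {zero}      f = refl
sum-split {suc a} {b} f = trans (cong (f zero +_) (sum-split {a} {b} (f ∘ suc))) (sym (+-assoc (f zero) _ _))

sum-mono : ∀ {k} {f g : Fin k → ℕ} → (∀ i → f i ≤ g i) → sum f ≤ sum g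
sum-mono {zero}  f≤g = z≤n
sum-mono {suc k} f≤g = +-mono-≤ (f≤g zero) (sum-mono (f≤g ∘ suc))

sum-mono-rigid : ∀ {k} {f g : Fin k → ℕ} → (∀ i → f i ≤ g i) → sum g ≤ sum f → ∀ i → g i ≡ f i
sum-mono-rigid {suc k} {f} {g} f≤g Σg≤Σf zero =
  ≤-antisym (+-cancelʳ-≤ _ _ _ (≤-trans Σg≤Σf (+-monoʳ-≤ (f zero) (sum-mono (f≤g ∘ suc))))) (f≤g zero)
sum-mono-rigid {suc k} {f} {g} f≤g Σg≤Σf (suc i) =
  sum-mono-rigid (f≤g ∘ suc) (+-cancelˡ-≤ (g zero) _ _ (≤-trans Σg≤Σf (+-monoˡ-≤ _ (f≤g zero)))) i

count-cong : ∀ {k} {P Q : Fin k → Bool} → (∀ i → P i ≡ Q i) → count P ≡ count Q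
count-cong P≡Q = sum-cong-≗ (cong indicator ∘ P≡Q)

count-all : ∀ {k} → count {k} (λ _ → true) ≡ k
count-all {zero}  = refl
count-all {suc k} = cong suc (count-all {k})

count-none : ∀ {k} (P : Fin k → Bool) → (∀ i → P i ≡ false) → count P ≡ 0
count-none {zero}  P none = refl
count-none {suc k} P none rewrite none zero = count-none (P ∘ suc) (none ∘ suc)

count-≤ : ∀ {k} (P : Fin k → Bool) → count P ≤ k
count-≤ {zero}  P = z≤n
count-≤ {suc k} P with P zero
... | true  = s≤s (count-≤ (P ∘ suc))
... | false = m≤n⇒m≤1+n (count-≤ (P ∘ suc))

count-mono : ∀ {k} {P Q : Fin k → Bool} → (∀ i → P i ≡ true → Q i ≡ true) → count P ≤ count Q
count-mono {P = P} {Q} P⊆Q = sum-mono (λ i → indicator-mono (P i) (Q i) (P⊆Q i))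
  where
  indicator-mono : ∀ a b → (a ≡ true → b ≡ true) → indicator a ≤ indicator b
  indicator-mono false b _   = z≤n
  indicator-mono true  b a⇒b rewrite a⇒b refl = ≤-refl

count-member : ∀ {k} (P : Fin k → Bool) i → P i ≡ true → 0 < count P
count-member P zero    Pi rewrite Pi = s≤s z≤n
count-member P (suc i) Pi = ≤-trans (count-member (P ∘ suc) i Pi) (m≤n+m _ (indicator (P zero)))

count-witness : ∀ {k} (P : Fin k → Bool) → 0 < count P → ∃ λ i → P i ≡ true
count-witness {suc k} P pos with P zero in P0
... | true  = zero , P0
... | false = let (i , Pi) = count-witness (P ∘ suc) pos in suc i , Pi

count-bounded : ∀ {k} (P : Fin k → Bool) r → (∀ i → P i ≡ true → toℕ i < r) → count P ≤ r
count-bounded {zero}  P r       below = z≤n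
count-bounded {suc k} P zero    below = ≤-reflexive (count-none P (λ i → ¬true (below i)))
  where
  ¬true : ∀ {b x} → (b ≡ true → x < 0) → b ≡ false
  ¬true {false} _   = refl
  ¬true {true}  lt0 with () ← lt0 refl
count-bounded {suc k} P (suc r) below with P zero
... | true  = s≤s (count-bounded (P ∘ suc) r (λ i Pi → s≤s⁻¹ (below (suc i) Pi)))
... | false = m≤n⇒m≤1+n (count-bounded (P ∘ suc) r (λ i Pi → s≤s⁻¹ (below (suc i) Pi)))

count-initial : ∀ {k} (P : Fin k → Bool) r → r ≤ k → (∀ i → toℕ i < r → P i ≡ true) → r ≤ count P
count-initial     P zero    r≤k       initial = z≤n
count-initial {suc k} P (suc r) (s≤s r≤k) initial rewrite initial zero (s≤s z≤n) =
  s≤s (count-initial (P ∘ suc) r r≤k (λ i lt → initial (suc i) (s≤s lt)))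

count-beyond : ∀ {k} (P : Fin k → Bool) r → r < count P → ∃ λ i → P i ≡ true × r ≤ toℕ i
count-beyond P r r<count with any? (λ i → (P i Data.Bool.≟ true) ×-dec (r ≤? toℕ i))
... | yes found = found
... | no  none  = ⊥-elim (<⇒≱ r<count (count-bounded P r (λ i Pi → ≰⇒> (λ r≤i → none (i , Pi , r≤i)))))

count-remove : ∀ {k} (P Q : Fin k → Bool) (w : Fin k) → P w ≡ true → Q w ≡ false →
               (∀ i → ¬ (i ≡ w) → P i ≡ Q i) → count P ≡ suc (count Q)
count-remove {suc k} P Q zero Pw Qw same rewrite Pw | Qw = cong suc (count-cong (λ i → same (suc i) (λ ())))
count-remove {suc k} P Q (suc w) Pw Qw same rewrite same zero (λ ()) =
  trans (cong (indicator (Q zero) +_)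
              (count-remove (P ∘ suc) (Q ∘ suc) w Pw Qw (λ i i≢w → same (suc i) (i≢w ∘ Data.Fin.Properties.suc-injective))))
        (+-suc (indicator (Q zero)) _)

count-partition : ∀ {k} (P Q : Fin k → Bool) → count (λ i → P i ∧ Q i) + count (λ i → not (P i) ∧ Q i) ≡ count Q
count-partition P Q =
  trans (sym (∑-distrib-+ (λ i → indicator (P i ∧ Q i)) (λ i → indicator (not (P i) ∧ Q i))))
        (sum-cong-≗ (λ i → split (P i) (Q i)))
  where
  split : ∀ a b → indicator (a ∧ b) + indicator (not a ∧ b) ≡ indicator b
  split true  b = +-identityʳ _
  split false b = refl

count-≥ : ∀ {N} a → a ≤ N → count {N} (λ j → a ≤ᵇ toℕ j) ≡ N ∸ a
count-≥ {zero}  zero    _         = refl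
count-≥ {suc N} zero    _         = cong suc (count-all {N})
count-≥ {suc N} (suc a) (s≤s a≤N) = trans (count-cong {N} (λ j → ≤ᵇ-suc a (toℕ j))) (count-≥ {N} a a≤N)
  where
  ≤ᵇ-suc : ∀ a b → (suc a ≤ᵇ suc b) ≡ (a ≤ᵇ b)
  ≤ᵇ-suc zero    b = refl
  ≤ᵇ-suc (suc a) b = refl

data Ascending (lo hi : ℕ) : ∀ {k} → Vec ℕ k → Set where
  []  : Ascending lo hi []
  _∷_ : ∀ {x k} {v : Vec ℕ k} → lo ≤ x × x < hi → Ascending x hi v → Ascending lo hi (x ∷ v)

NonDecreasing : ∀ {k} → Vec ℕ k → Set
NonDecreasing {k} v = ∀ (i i′ : Fin k) → toℕ i ≤ toℕ i′ → lookup v i ≤ lookup v i′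

ascending-≥ : ∀ {lo hi k} {v : Vec ℕ k} → Ascending lo hi v → ∀ i → lo ≤ lookup v i
ascending-≥ ((lo≤x , _) ∷ _)  zero    = lo≤x
ascending-≥ ((lo≤x , _) ∷ xs) (suc i) = ≤-trans lo≤x (ascending-≥ xs i)

ascending-< : ∀ {lo hi k} {v : Vec ℕ k} → Ascending lo hi v → ∀ i → lookup v i < hi
ascending-< ((_ , x<hi) ∷ _)  zero    = x<hi
ascending-< (_          ∷ xs) (suc i) = ascending-< xs i

ascending-nonDecreasing : ∀ {lo hi k} {v : Vec ℕ k} → Ascending lo hi v → NonDecreasing v
ascending-nonDecreasing (_ ∷ xs) zero    zero     _         = ≤-refl
ascending-nonDecreasing (_ ∷ xs) zero    (suc i′) _         = ascending-≥ xs i′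
ascending-nonDecreasing (_ ∷ xs) (suc i) (suc i′) (s≤s i≤i′) = ascending-nonDecreasing xs i i′ i≤i′

nonDecreasing⇒ascending : ∀ lo hi {k} (v : Vec ℕ k) →
                   (∀ i → lo ≤ lookup v i) → (∀ i → lookup v i < hi) → NonDecreasing v → Ascending lo hi v
nonDecreasing⇒ascending lo hi []      _   _   _      = []
nonDecreasing⇒ascending lo hi (x ∷ v) ≥lo <hi sorted =
  (≥lo zero , <hi zero) ∷ nonDecreasing⇒ascending x hi v (λ i → sorted zero (suc i) z≤n) (<hi ∘ suc)
                                            (λ i i′ le → sorted (suc i) (suc i′) (s≤s le))

ascending-weaken : ∀ {lo lo′ hi k} {v : Vec ℕ k} → lo ≤ lo′ → Ascending lo′ hi v → Ascending lo hi v
ascending-weaken lo≤lo′ []                   = []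
ascending-weaken lo≤lo′ ((lo′≤x , x<) ∷ xs) = (≤-trans lo≤lo′ lo′≤x , x<) ∷ xs

-- ascending k lo s lists the ascending vectors of length k with entries in [lo, lo + s):
-- those starting with lo, followed by those with all entries ≥ lo + 1.
ascending : (k lo s : ℕ) → List (Vec ℕ k)
ascending zero    lo s       = [] ∷ []
ascending (suc k) lo zero    = []
ascending (suc k) lo (suc s) = List.map (lo ∷_) (ascending k lo (suc s)) List.++ ascending (suc k) (suc lo) s

ascending-sound : ∀ k lo s {v} → v ∈ ascending k lo s → Ascending lo (lo + s) v
ascending-sound zero    lo s       (here refl) = []
ascending-sound (suc k) lo (suc s) v∈ with ∈-++⁻ (List.map (lo ∷_) (ascending k lo (suc s))) v∈
... | inj₁ v∈head with ∈-map⁻ (lo ∷_) v∈head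
...   | (w , w∈ , refl) = (≤-refl , m<m+n lo (s≤s z≤n)) ∷ ascending-sound k lo (suc s) w∈
ascending-sound (suc k) lo (suc s) {v} v∈ | inj₂ v∈tail =
  subst (λ hi → Ascending lo hi v) (sym (+-suc lo s))
        (ascending-weaken (n≤1+n lo) (ascending-sound (suc k) (suc lo) s v∈tail))

ascending-complete : ∀ k lo s {v} → Ascending lo (lo + s) v → v ∈ ascending k lo s
ascending-complete zero    lo s       []                    = here refl
ascending-complete (suc k) lo zero    ((lo≤x , x<lo+0) ∷ _) =
  ⊥-elim (<⇒≱ x<lo+0 (≤-trans (≤-reflexive (+-identityʳ lo)) lo≤x))
ascending-complete (suc k) lo (suc s) {x ∷ v} ((lo≤x , x<) ∷ xs) with m≤n⇒m<n∨m≡n lo≤x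
... | inj₂ refl = ∈-++⁺ˡ (∈-map⁺ (lo ∷_) (ascending-complete k lo (suc s) xs))
... | inj₁ lo<x = ∈-++⁺ʳ (List.map (lo ∷_) (ascending k lo (suc s)))
                         (ascending-complete (suc k) (suc lo) s
                           (subst (λ hi → Ascending (suc lo) hi (x ∷ v)) (+-suc lo s) ((lo<x , x<) ∷ xs)))

ascending-unique : ∀ k lo s → Unique (ascending k lo s)
ascending-unique zero    lo s       = [] ∷ []
ascending-unique (suc k) lo zero    = []
ascending-unique (suc k) lo (suc s) =
  Unique.++⁺ (Unique.map⁺ ∷-injectiveʳ (ascending-unique k lo (suc s))) (ascending-unique (suc k) (suc lo) s) disjoint
  where
  disjoint : ∀ {v} → ¬ (v ∈ List.map (lo ∷_) (ascending k lo (suc s)) × v ∈ ascending (suc k) (suc lo) s)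
  disjoint (v∈head , v∈tail) with ∈-map⁻ (lo ∷_) v∈head
  ... | (w , _ , refl) with (lo<lo , _) ∷ _ ← ascending-sound (suc k) (suc lo) s v∈tail = 1+n≰n lo<lo

ascending-length : ∀ k lo s → length (ascending k lo (suc s)) ≡ (k + s) C k
ascending-length zero    lo s       = refl
ascending-length (suc k) lo zero    = begin
  length (List.map (lo ∷_) (ascending k lo 1) List.++ []) ≡⟨ cong length (++-identityʳ (List.map (lo ∷_) (ascending k lo 1))) ⟩
  length (List.map (lo ∷_) (ascending k lo 1))            ≡⟨ length-map (lo ∷_) (ascending k lo 1) ⟩
  length (ascending k lo 1)                               ≡⟨ ascending-length k lo 0 ⟩
  (k + 0) C k                                             ≡⟨ cong (_C k) (+-identityʳ k) ⟩
  k C k                                                   ≡⟨ nCn≡1 k ⟩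
  1                                                       ≡⟨ nCn≡1 (suc k) ⟨
  suc k C suc k                                           ≡⟨ cong (_C suc k) (+-identityʳ (suc k)) ⟨
  (suc k + 0) C suc k                                     ∎
  where open ≡-Reasoning
ascending-length (suc k) lo (suc s) = begin
  length (List.map (lo ∷_) (ascending k lo (suc (suc s))) List.++ ascending (suc k) (suc lo) (suc s))
    ≡⟨ length-++ (List.map (lo ∷_) (ascending k lo (suc (suc s)))) ⟩
  length (List.map (lo ∷_) (ascending k lo (suc (suc s)))) + length (ascending (suc k) (suc lo) (suc s))
    ≡⟨ cong₂ _+_ (trans (length-map (lo ∷_) (ascending k lo (suc (suc s)))) (ascending-length k lo (suc s)))
                 (ascending-length (suc k) (suc lo) s) ⟩
  (k + suc s) C k + (suc k + s) C suc k
    ≡⟨ cong (λ N → (k + suc s) C k + N C suc k) (sym (+-suc k s)) ⟩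
  (k + suc s) C k + (k + suc s) C suc k
    ≡⟨ nCk+nC[k+1]≡[n+1]C[k+1] (k + suc s) k ⟩
  (suc k + suc s) C suc k ∎
  where open ≡-Reasoning

-- The vertex set of D_{m,n} for m = m' + 1: position i ↑ˡ n is the vertex v_{i+1} of the
-- first part A (the sink's part), position m' ↑ʳ j is v_{m+j} of the second part B.
module Bipartite (m' n : ℕ) where
  open Sandpile (suc m') n

  V : Set
  V = Fin (m' + n)

  inA-↑ˡ : ∀ i → inA (i ↑ˡ n) ≡ true
  inA-↑ˡ i rewrite toℕ-↑ˡ i n = <ᵇ-true (toℕ<n i)

  inA-↑ʳ : ∀ j → inA (m' ↑ʳ j) ≡ false
  inA-↑ʳ j rewrite toℕ-↑ʳ m' j = <ᵇ-false (m≤m+n m' (toℕ j))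

  data Side : V → Set where
    inside-A : (i : Fin m') → Side (i ↑ˡ n)
    inside-B : (j : Fin n)  → Side (m' ↑ʳ j)

  side : ∀ k → Side k
  side k with splitAt m' k in split
  ... | inj₁ i = subst Side (splitAt⁻¹-↑ˡ split) (inside-A i)
  ... | inj₂ j = subst Side (splitAt⁻¹-↑ʳ split) (inside-B j)

  deg-↑ˡ : ∀ i → deg (i ↑ˡ n) ≡ n
  deg-↑ˡ i = cong (λ b → if b then n else suc m') (inA-↑ˡ i)

  deg-↑ʳ : ∀ j → deg (m' ↑ʳ j) ≡ suc m'
  deg-↑ʳ j = cong (λ b → if b then n else suc m') (inA-↑ʳ j)

  onA : (V → Bool) → Fin m' → Bool
  onA P i = P (i ↑ˡ n)

  onB : (V → Bool) → Fin n → Bool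
  onB P j = P (m' ↑ʳ j)

  count-by-side : (P : V → Bool) → count P ≡ count (onA P) + count (onB P)
  count-by-side P = sum-split {m'} {n} (λ k → indicator (P k))

  count-∧inA : ∀ P → count (λ k → P k ∧ inA k) ≡ count (onA P)
  count-∧inA P = begin
    count (λ k → P k ∧ inA k)
      ≡⟨ count-by-side _ ⟩
    count (λ i → P (i ↑ˡ n) ∧ inA (i ↑ˡ n)) + count (λ j → P (m' ↑ʳ j) ∧ inA (m' ↑ʳ j))
      ≡⟨ cong₂ _+_ (count-cong (λ i → trans (cong (P (i ↑ˡ n) ∧_) (inA-↑ˡ i)) (∧-identityʳ _)))
                   (count-none _ (λ j → trans (cong (P (m' ↑ʳ j) ∧_) (inA-↑ʳ j)) (∧-zeroʳ _))) ⟩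
    count (onA P) + 0
      ≡⟨ +-identityʳ _ ⟩
    count (onA P) ∎
    where open ≡-Reasoning

  count-∧inB : ∀ P → count (λ k → P k ∧ not (inA k)) ≡ count (onB P)
  count-∧inB P = begin
    count (λ k → P k ∧ not (inA k))
      ≡⟨ count-by-side _ ⟩
    count (λ i → P (i ↑ˡ n) ∧ not (inA (i ↑ˡ n))) + count (λ j → P (m' ↑ʳ j) ∧ not (inA (m' ↑ʳ j)))
      ≡⟨ cong₂ _+_ (count-none _ (λ i → trans (cong (λ b → P (i ↑ˡ n) ∧ not b) (inA-↑ˡ i)) (∧-zeroʳ _)))
                   (count-cong (λ j → trans (cong (λ b → P (m' ↑ʳ j) ∧ not b) (inA-↑ʳ j)) (∧-identityʳ _))) ⟩
    count (onB P) ∎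
    where open ≡-Reasoning

  adjacent : V → V → Bool
  adjacent v k = inA v xor inA k

  adjacent-irrefl : ∀ v → adjacent v v ≡ false
  adjacent-irrefl v with inA v
  ... | true  = refl
  ... | false = refl

  neighboursIn : (V → Bool) → V → ℕ
  neighboursIn F v = count (λ k → F k ∧ adjacent v k)

  -- Out-degree = non-sink neighbours + arcs to the sink (only B is adjacent to the sink).
  nonSinkDeg : V → ℕ
  nonSinkDeg v = if inA v then n else m'

  sinkArcs : V → ℕ
  sinkArcs v = if inA v then 0 else 1

  deg-split : ∀ v → deg v ≡ nonSinkDeg v + sinkArcs v
  deg-split v with inA v
  ... | true  = sym (+-identityʳ n)
  ... | false = +-comm 1 m'

  count-adjacent : ∀ v → count (adjacent v) ≡ nonSinkDeg v
  count-adjacent v with inA v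
  ... | true  = trans (count-∧inB (λ _ → true)) count-all
  ... | false = trans (count-∧inA (λ _ → true)) count-all

  neighboursIn-complement : ∀ T v → neighboursIn T v + neighboursIn (not ∘ T) v ≡ nonSinkDeg v
  neighboursIn-complement T v = trans (count-partition T (adjacent v)) (count-adjacent v)

  neighboursIn-≤ : ∀ F v → neighboursIn F v ≤ nonSinkDeg v
  neighboursIn-≤ F v = subst (neighboursIn F v ≤_) (neighboursIn-complement F v) (m≤m+n _ _)

  neighboursIn-↑ˡ : ∀ F i → neighboursIn F (i ↑ˡ n) ≡ count (onB F)
  neighboursIn-↑ˡ F i rewrite inA-↑ˡ i = count-∧inB F

  neighboursIn-↑ʳ : ∀ F j → neighboursIn F (m' ↑ʳ j) ≡ count (onA F)
  neighboursIn-↑ʳ F j rewrite inA-↑ʳ j = count-∧inA F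

module DharCriterion (m' n : ℕ) where
  open Sandpile (suc m') n
  open Bipartite m' n

  -- Entries of a toppled configuration.  `topple x j` is a tabulation; naming its entry
  -- function lets us evaluate it.
  private
    toppleEntries : ∀ x j → Σ (V → ℕ) λ g → topple x j ≡ tabulate g
    toppleEntries x j = _ , refl

    entry-self : ∀ x j → proj₁ (toppleEntries x j) j ≡ lookup x j ∸ deg j
    entry-self x j with j ≟ j
    ... | yes _   = refl
    ... | no j≢j = ⊥-elim (j≢j refl)

    entry-other : ∀ x j k → ¬ k ≡ j →
                  proj₁ (toppleEntries x j) k ≡ (if adjacent k j then suc (lookup x k) else lookup x k)
    entry-other x j k k≢j with k ≟ j
    ... | yes k≡j = ⊥-elim (k≢j k≡j)
    ... | no _    = refl

  topple-self : ∀ x j → lookup (topple x j) j ≡ lookup x j ∸ deg j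
  topple-self x j = trans (lookup∘tabulate _ j) (entry-self x j)

  topple-other : ∀ x j k → ¬ k ≡ j → lookup (topple x j) k ≡ (if adjacent k j then suc (lookup x k) else lookup x k)
  topple-other x j k k≢j = trans (lookup∘tabulate _ k) (entry-other x j k k≢j)

  topple-adjacent : ∀ x j k → adjacent k j ≡ true → lookup (topple x j) k ≡ suc (lookup x k)
  topple-adjacent x j k k∼j = trans (topple-other x j k k≢j) (cong (λ b → if b then _ else _) k∼j)
    where
    k≢j : ¬ k ≡ j
    k≢j refl = case trans (sym k∼j) (adjacent-irrefl k) of λ ()

  topple-nonadjacent : ∀ x j k → ¬ k ≡ j → adjacent k j ≡ false → lookup (topple x j) k ≡ lookup x k
  topple-nonadjacent x j k k≢j k≁j = trans (topple-other x j k k≢j) (cong (λ b → if b then _ else _) k≁j)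

  topple-other-≥ : ∀ x j k → ¬ k ≡ j → lookup x k ≤ lookup (topple x j) k
  topple-other-≥ x j k k≢j with adjacent k j in k∼j
  ... | true  = ≤-trans (n≤1+n _) (≤-reflexive (sym (topple-adjacent x j k k∼j)))
  ... | false = ≤-reflexive (sym (topple-nonadjacent x j k k≢j k∼j))

  _⊆_ : (V → Bool) → (V → Bool) → Set
  F ⊆ G = ∀ k → F k ≡ true → G k ≡ true

  NonEmpty : (V → Bool) → Set
  NonEmpty F = ∃ λ k → F k ≡ true

  update : (V → Bool) → V → Bool → V → Bool
  update F j b k = if does (k ≟ j) then b else F k

  update-self : ∀ F j b → update F j b j ≡ b
  update-self F j b with j ≟ j
  ... | yes _   = refl
  ... | no j≢j = ⊥-elim (j≢j refl)

  update-other : ∀ F j b k → ¬ k ≡ j → update F j b k ≡ F k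
  update-other F j b k k≢j with k ≟ j
  ... | yes k≡j = ⊥-elim (k≢j k≡j)
  ... | no _    = refl

  neighboursIn-away : ∀ F G j w → (∀ k → ¬ k ≡ j → F k ≡ G k) → adjacent w j ≡ false →
                      neighboursIn F w ≡ neighboursIn G w
  neighboursIn-away F G j w same w≁j = count-cong agree
    where
    agree : ∀ k → (F k ∧ adjacent w k) ≡ (G k ∧ adjacent w k)
    agree k with k ≟ j
    ... | yes refl = trans (cong (F k ∧_) w≁j) (trans (∧-zeroʳ (F k)) (sym (trans (cong (G k ∧_) w≁j) (∧-zeroʳ (G k)))))
    ... | no k≢j   = cong (_∧ adjacent w k) (same k k≢j)

  neighboursIn-near : ∀ F G j w → (∀ k → ¬ k ≡ j → F k ≡ G k) → F j ≡ true → G j ≡ false →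
                      adjacent w j ≡ true → neighboursIn F w ≡ suc (neighboursIn G w)
  neighboursIn-near F G j w same Fj Gj w∼j =
    count-remove (λ k → F k ∧ adjacent w k) (λ k → G k ∧ adjacent w k) j
                 (cong₂ _∧_ Fj w∼j) (cong (_∧ adjacent w j) Gj) (λ k k≢j → cong (_∧ adjacent w k) (same k k≢j))

  Forbidden : Config → (V → Bool) → Set
  Forbidden x F = NonEmpty F × (∀ w → F w ≡ true → lookup x w < neighboursIn F w)

  -- The constructive negation: every nonempty F has a vertex with at least as many
  -- grains as neighbours in F.
  FSC-free : Config → Set
  FSC-free u = ∀ F → NonEmpty F → ∃ λ w → F w ≡ true × neighboursIn F w ≤ lookup u w

  -- A forbidden subconfiguration after a toppling at j yields one before it: F itself if
  -- j ∉ F, and F ∖ {j} if j ∈ F (j had fewer grains than neighbours in F, so F ∖ {j} ≠ ∅).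
  forbidden-before-away : ∀ x j F → F j ≡ false → Forbidden (topple x j) F → Forbidden x F
  forbidden-before-away x j F Fj (nonEmpty , short) = nonEmpty , λ w Fw →
    ≤-<-trans (topple-other-≥ x j w (λ { refl → case trans (sym Fw) Fj of λ () })) (short w Fw)

  forbidden-before-at : ∀ x j F → F j ≡ true → Forbidden (topple x j) F → Forbidden x (update F j false)
  forbidden-before-at x j F Fj (_ , short) = nonEmpty , short′
    where
    F′ = update F j false
    F≐F′ : ∀ k → ¬ k ≡ j → F k ≡ F′ k
    F≐F′ k k≢j = sym (update-other F j false k k≢j)
    nonEmpty : NonEmpty F′
    nonEmpty with count-witness (λ k → F′ k ∧ adjacent j k)
                    (subst (0 <_) (neighboursIn-away F F′ j j F≐F′ (adjacent-irrefl j)) (≤-<-trans z≤n (short j Fj)))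
    ... | k , F′k∧j∼k = k , ∧-trueˡ F′k∧j∼k
    short′ : ∀ w → F′ w ≡ true → lookup x w < neighboursIn F′ w
    short′ w F′w with w ≟ j
    ... | yes refl with () ← F′w
    ... | no w≢j with adjacent w j in w∼j
    ...   | true  = s≤s⁻¹ (subst₂ _<_ (topple-adjacent x j w w∼j)
                                      (neighboursIn-near F F′ j w F≐F′ Fj (update-self F j false) w∼j) (short w F′w))
    ...   | false = subst₂ _<_ (topple-nonadjacent x j w w≢j w∼j) (neighboursIn-away F F′ j w F≐F′ w∼j) (short w F′w)

  forbidden-before : ∀ {x y} F → Step x y → Forbidden y F → ∃ (Forbidden x)
  forbidden-before {x} F (j , _ , refl) forbidden with F j in Fj
  ... | true  = update F j false , forbidden-before-at x j F Fj forbidden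
  ... | false = F , forbidden-before-away x j F Fj forbidden

  forbidden-before* : ∀ {x y} F → Star Step x y → Forbidden y F → ∃ (Forbidden x)
  forbidden-before* F ε               forbidden = F , forbidden
  forbidden-before* F (step ◅ steps) forbidden =
    let (F′ , forbidden′) = forbidden-before* F steps forbidden in forbidden-before F′ step forbidden′

  -- Either some member of F is good (a decidable search), or
  -- F is forbidden for u; pulling it back along the stabilisation x →* u gives a forbidden
  -- set for x, impossible since x_k ≥ d_k ≥ #neighbours.
  recurrent⇒FSC-free : ∀ u → Recurrent u → FSC-free u
  recurrent⇒FSC-free u (_ , x , x≥deg , steps , _) F nonEmpty
    with any? (λ w → (F w Data.Bool.≟ true) ×-dec (neighboursIn F w ≤? lookup u w))
  ... | yes found = found
  ... | no  none  with forbidden-before* F steps (nonEmpty , λ w Fw → ≰⇒> (λ le → none (w , Fw , le)))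
  ...   | F′ , (k , F′k) , short = ⊥-elim (<⇒≱ (short k F′k) (begin
    neighboursIn F′ k         ≤⟨ neighboursIn-≤ F′ k ⟩
    nonSinkDeg k              ≤⟨ m≤m+n _ _ ⟩
    nonSinkDeg k + sinkArcs k ≡⟨ deg-split k ⟨
    deg k                     ≤⟨ x≥deg k ⟩
    lookup x k                ∎))
    where open ≤-Reasoning

  -- Burning: toppling every vertex of a set T once, starting from y.
  lost : (V → Bool) → V → ℕ
  lost T k = if T k then deg k else 0

  afterToppling : Config → (V → Bool) → Config
  afterToppling y T = tabulate λ k → (lookup y k + neighboursIn T k) ∸ lost T k

  Legal : Config → (V → Bool) → Set
  Legal y T = ∀ k → lost T k ≤ lookup y k + neighboursIn T k

  lookup-afterToppling : ∀ y T k → lookup (afterToppling y T) k ≡ (lookup y k + neighboursIn T k) ∸ lost T k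
  lookup-afterToppling y T k = lookup∘tabulate _ k

  afterToppling-none : ∀ y → afterToppling y (λ _ → false) ≡ y
  afterToppling-none y = lookup-ext λ k → begin
    lookup (afterToppling y (λ _ → false)) k            ≡⟨ lookup-afterToppling y (λ _ → false) k ⟩
    lookup y k + neighboursIn (λ _ → false) k           ≡⟨ cong (lookup y k +_) (count-none (λ j → false ∧ adjacent k j) (λ _ → refl)) ⟩
    lookup y k + 0                                      ≡⟨ +-identityʳ _ ⟩
    lookup y k                                          ∎
    where open ≡-Reasoning

  afterToppling-cong : ∀ y {T T′} → (∀ k → T k ≡ T′ k) → afterToppling y T ≡ afterToppling y T′
  afterToppling-cong y T≐T′ = tabulate-cong λ k →
    cong₂ (λ c b → (lookup y k + c) ∸ (if b then deg k else 0))
          (count-cong (λ j → cong (_∧ adjacent k j) (T≐T′ j))) (T≐T′ k)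

  neighboursIn-mono : ∀ {T T′} → T ⊆ T′ → ∀ v → neighboursIn T v ≤ neighboursIn T′ v
  neighboursIn-mono T⊆T′ v = count-mono (λ k Tk∧v∼k → cong₂ _∧_ (T⊆T′ k (∧-trueˡ Tk∧v∼k)) (∧-trueʳ Tk∧v∼k))

  lookup-afterToppling′ : ∀ y T k {c b} → neighboursIn T k ≡ c → T k ≡ b →
                          lookup (afterToppling y T) k ≡ (lookup y k + c) ∸ (if b then deg k else 0)
  lookup-afterToppling′ y T k refl refl = lookup-afterToppling y T k

  topple-afterToppling : ∀ y T w → T w ≡ false → Legal y T →
                         topple (afterToppling y T) w ≡ afterToppling y (update T w true)
  topple-afterToppling y T w Tw legal = lookup-ext entry
    where
    T′ = update T w true
    T′≐T : ∀ k → ¬ k ≡ w → T′ k ≡ T k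
    T′≐T = update-other T w true
    open ≡-Reasoning
    entry : ∀ k → lookup (topple (afterToppling y T) w) k ≡ lookup (afterToppling y T′) k
    entry k with k ≟ w
    ... | yes refl = begin
      lookup (topple (afterToppling y T) k) k          ≡⟨ topple-self _ k ⟩
      lookup (afterToppling y T) k ∸ deg k             ≡⟨ cong (_∸ deg k) (lookup-afterToppling′ y T k refl Tw) ⟩
      (lookup y k + neighboursIn T k) ∸ deg k          ≡⟨ lookup-afterToppling′ y T′ k (neighboursIn-away T′ T k k (update-other T k true)
                                                              (adjacent-irrefl k)) (update-self T k true) ⟨
      lookup (afterToppling y T′) k                    ∎
    ... | no k≢w with adjacent k w in k∼w
    ...   | true = begin
      lookup (topple (afterToppling y T) w) k          ≡⟨ topple-adjacent _ w k k∼w ⟩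
      suc (lookup (afterToppling y T) k)               ≡⟨ cong suc (lookup-afterToppling y T k) ⟩
      suc ((lookup y k + neighboursIn T k) ∸ lost T k) ≡⟨ +-∸-assoc 1 (legal k) ⟨
      suc (lookup y k + neighboursIn T k) ∸ lost T k   ≡⟨ cong (_∸ lost T k) (+-suc (lookup y k) _) ⟨
      (lookup y k + suc (neighboursIn T k)) ∸ lost T k ≡⟨ lookup-afterToppling′ y T′ k (neighboursIn-near T′ T w k T′≐T
                                                              (update-self T w true) Tw k∼w) (T′≐T k k≢w) ⟨
      lookup (afterToppling y T′) k                    ∎
    ...   | false = begin
      lookup (topple (afterToppling y T) w) k          ≡⟨ topple-nonadjacent _ w k k≢w k∼w ⟩
      lookup (afterToppling y T) k                     ≡⟨ lookup-afterToppling y T k ⟩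
      (lookup y k + neighboursIn T k) ∸ lost T k       ≡⟨ lookup-afterToppling′ y T′ k (neighboursIn-away T′ T w k T′≐T k∼w)
                                                              (T′≐T k k≢w) ⟨
      lookup (afterToppling y T′) k                    ∎

  missing : (V → Bool) → (V → Bool) → V → Bool
  missing G T k = G k ∧ not (T k)

  Burnable : Config → (V → Bool) → Set
  Burnable y G = ∀ T → T ⊆ G → Legal y T → NonEmpty (missing G T) →
                 ∃ λ w → missing G T w ≡ true × deg w ≤ lookup y w + neighboursIn T w

  legal-none : ∀ y → Legal y (λ _ → false)
  legal-none y k = z≤n

  legal-extend : ∀ y T w → Legal y T → T w ≡ false → deg w ≤ lookup y w + neighboursIn T w →
                 Legal y (update T w true)
  legal-extend y T w legal Tw unstable k = ≤-trans (lost-bound k) (+-monoʳ-≤ (lookup y k) (neighboursIn-mono T⊆T′ k))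
    where
    T′ = update T w true
    T⊆T′ : T ⊆ T′
    T⊆T′ k Tk with k ≟ w
    ... | yes _ = refl
    ... | no _  = Tk
    lost-bound : ∀ k → lost T′ k ≤ lookup y k + neighboursIn T k
    lost-bound k with k ≟ w
    ... | yes refl = unstable
    ... | no _     = legal k

  burn : ∀ y G → Burnable y G → ∀ r T → count (missing G T) ≡ r → T ⊆ G → Legal y T →
         Star Step (afterToppling y T) (afterToppling y G)
  burn y G burnable zero T none T⊆G legal = subst (Star Step _) (afterToppling-cong y T≐G) ε
    where
    T≐G : ∀ k → T k ≡ G k
    T≐G k with T k in Tk | G k in Gk
    ... | true  | _     = trans (sym (T⊆G k Tk)) Gk
    ... | false | false = refl
    ... | false | true  = ⊥-elim (<⇒≱ (count-member (missing G T) k (cong₂ (λ g t → g ∧ not t) Gk Tk)) (≤-reflexive none))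
  burn y G burnable (suc r) T missing≡1+r T⊆G legal with burnable T T⊆G legal
      (count-witness (missing G T) (subst (0 <_) (sym missing≡1+r) (s≤s z≤n)))
  ... | w , Gw∧¬Tw , unstable =
    (w , unstable′ , sym (topple-afterToppling y T w Tw legal)) ◅
    burn y G burnable r T′ (suc-injective (trans (sym missing-shrinks) missing≡1+r)) T′⊆G (legal-extend y T w legal Tw unstable)
    where
    T′ = update T w true
    Gw : G w ≡ true
    Gw = ∧-trueˡ Gw∧¬Tw
    Tw : T w ≡ false
    Tw = not-true (∧-trueʳ Gw∧¬Tw)
    unstable′ : deg w ≤ lookup (afterToppling y T) w
    unstable′ = subst (deg w ≤_) (sym (trans (lookup-afterToppling y T w)
                  (cong (λ b → (lookup y w + neighboursIn T w) ∸ (if b then deg w else 0)) Tw))) unstable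
    T′⊆G : T′ ⊆ G
    T′⊆G k T′k with k ≟ w
    ... | yes refl = Gw
    ... | no _     = T⊆G k T′k
    missing-shrinks : count (missing G T) ≡ suc (count (missing G T′))
    missing-shrinks = count-remove (missing G T) (missing G T′) w Gw∧¬Tw
      (trans (cong (λ b → G w ∧ not b) (update-self T w true)) (∧-zeroʳ (G w)))
      (λ k k≢w → cong (λ b → G k ∧ not b) (sym (update-other T w true k k≢w)))

  raiseB : Config → ℕ → Config
  raiseB u c = tabulate λ k → lookup u k + (if inA k then 0 else c)

  raiseB-zero : ∀ u → raiseB u 0 ≡ u
  raiseB-zero u = lookup-ext λ k → trans (lookup∘tabulate _ k) (no-extra k)
    where
    no-extra : ∀ k → lookup u k + (if inA k then 0 else 0) ≡ lookup u k
    no-extra k with inA k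
    ... | true  = +-identityʳ _
    ... | false = +-identityʳ _

  allVertices : V → Bool
  allVertices _ = true

  -- A round of burning topples every vertex once.  It can be carried out if u is FSC-free:
  -- the vertices not yet toppled never form a forbidden subconfiguration of u, and the
  -- extra grain on B pays for the arc to the sink.
  round-burnable : ∀ u → FSC-free u → ∀ c → Burnable (raiseB u (suc c)) allVertices
  round-burnable u fsc-free c T _ _ (k , ¬Tk) with fsc-free (not ∘ T) (k , ¬Tk)
  ... | w , ¬Tw , outside≤u = w , ¬Tw , (begin
    deg w                                                    ≡⟨ deg-split w ⟩
    nonSinkDeg w + sinkArcs w                                ≡⟨ cong (_+ sinkArcs w) (neighboursIn-complement T w) ⟨
    neighboursIn T w + neighboursIn (not ∘ T) w + sinkArcs w ≤⟨ +-monoˡ-≤ (sinkArcs w) (+-monoʳ-≤ (neighboursIn T w) outside≤u) ⟩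
    neighboursIn T w + lookup u w + sinkArcs w               ≤⟨ +-monoʳ-≤ (neighboursIn T w + lookup u w) (sinkArcs≤extra w) ⟩
    neighboursIn T w + lookup u w + extra w                  ≡⟨ +-assoc (neighboursIn T w) _ _ ⟩
    neighboursIn T w + (lookup u w + extra w)                ≡⟨ +-comm (neighboursIn T w) _ ⟩
    (lookup u w + extra w) + neighboursIn T w                ≡⟨ cong (_+ neighboursIn T w) (lookup∘tabulate _ w) ⟨
    lookup (raiseB u (suc c)) w + neighboursIn T w           ∎)
    where
    open ≤-Reasoning
    extra : V → ℕ
    extra k = if inA k then 0 else suc c
    sinkArcs≤extra : ∀ w → sinkArcs w ≤ extra w
    sinkArcs≤extra w with inA w
    ... | true  = z≤n
    ... | false = s≤s z≤n

  -- A vertex of A loses n and gains n; a vertex of B loses m' + 1 and gains m'.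
  round-result : ∀ u c → afterToppling (raiseB u (suc c)) allVertices ≡ raiseB u c
  round-result u c = lookup-ext λ k → begin
    lookup (afterToppling (raiseB u (suc c)) allVertices) k                 ≡⟨ lookup-afterToppling (raiseB u (suc c)) allVertices k ⟩
    (lookup (raiseB u (suc c)) k + count (adjacent k)) ∸ deg k              ≡⟨ cong₂ (λ a b → (a + b) ∸ deg k) (lookup∘tabulate _ k) (count-adjacent k) ⟩
    (lookup u k + (if inA k then 0 else suc c) + nonSinkDeg k) ∸ deg k      ≡⟨ one-round k ⟩
    lookup u k + (if inA k then 0 else c)                                   ≡⟨ lookup∘tabulate _ k ⟨
    lookup (raiseB u c) k                                                   ∎
    where
    open ≡-Reasoning
    one-round : ∀ k → (lookup u k + (if inA k then 0 else suc c) + nonSinkDeg k) ∸ deg k ≡ lookup u k + (if inA k then 0 else c)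
    one-round k with inA k
    ... | true  = m+n∸n≡m _ n
    ... | false = begin
      (lookup u k + suc c + m') ∸ suc m'   ≡⟨ cong (_∸ suc m') (+-assoc (lookup u k) (suc c) m') ⟩
      (lookup u k + (suc c + m')) ∸ suc m' ≡⟨ cong (λ z → (lookup u k + z) ∸ suc m') (+-suc c m') ⟨
      (lookup u k + (c + suc m')) ∸ suc m' ≡⟨ cong (_∸ suc m') (+-assoc (lookup u k) c (suc m')) ⟨
      (lookup u k + c + suc m') ∸ suc m'   ≡⟨ m+n∸n≡m (lookup u k + c) (suc m') ⟩
      lookup u k + c                       ∎

  burning-round : ∀ u → FSC-free u → ∀ c → Star Step (raiseB u (suc c)) (raiseB u c)
  burning-round u fsc-free c =
    subst₂ (Star Step) (afterToppling-none y) (round-result u c)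
           (burn y allVertices (round-burnable u fsc-free c) _ (λ _ → false) refl (λ _ _ → refl) (legal-none y))
    where
    y = raiseB u (suc c)

  drain : ∀ u → FSC-free u → ∀ c → Star Step (raiseB u c) u
  drain u fsc-free zero    = subst (λ x → Star Step x u) (sym (raiseB-zero u)) ε
  drain u fsc-free (suc c) = burning-round u fsc-free c ◅◅ drain u fsc-free c

  -- u + d has x_k ≥ d_k everywhere; toppling every vertex of A once (A is independent,
  -- so each of them stays unstable) leaves u with m' + 1 + m' extra grains on B.
  loaded : Config → Config
  loaded u = tabulate λ k → lookup u k + deg k

  loaded-≥deg : ∀ u k → deg k ≤ lookup (loaded u) k
  loaded-≥deg u k = subst (deg k ≤_) (sym (lookup∘tabulate _ k)) (m≤n+m (deg k) (lookup u k))

  -- A vertex of A loses n and gains nothing from A; a vertex of B gains m'.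
  unload-result : ∀ u → afterToppling (loaded u) inA ≡ raiseB u (suc m' + m')
  unload-result u = lookup-ext λ k → trans (lookup-afterToppling (loaded u) inA k)
                      (trans (cong (λ x → (x + neighboursIn inA k) ∸ lost inA k) (lookup∘tabulate _ k))
                             (trans (unload k) (sym (lookup∘tabulate _ k))))
    where
    open ≡-Reasoning
    unload : ∀ k → (lookup u k + deg k + neighboursIn inA k) ∸ lost inA k ≡ lookup u k + (if inA k then 0 else suc m' + m')
    unload k with inA k
    ... | true  = begin
      (lookup u k + n + count (λ j → inA j ∧ not (inA j))) ∸ n ≡⟨ cong (λ z → (lookup u k + n + z) ∸ n) (count-none _ (λ j → ∧-inverseʳ (inA j))) ⟩
      (lookup u k + n + 0) ∸ n                                 ≡⟨ cong (_∸ n) (+-identityʳ _) ⟩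
      (lookup u k + n) ∸ n                                     ≡⟨ m+n∸n≡m _ n ⟩
      lookup u k                                               ≡⟨ +-identityʳ _ ⟨
      lookup u k + 0                                           ∎
    ... | false = begin
      lookup u k + suc m' + count (λ j → inA j ∧ inA j)        ≡⟨ cong (lookup u k + suc m' +_) (count-cong (λ j → ∧-idem (inA j))) ⟩
      lookup u k + suc m' + count inA                          ≡⟨ cong (lookup u k + suc m' +_) (trans (count-∧inA (λ _ → true)) count-all) ⟩
      lookup u k + suc m' + m'                                 ≡⟨ +-assoc (lookup u k) (suc m') m' ⟩
      lookup u k + (suc m' + m')                               ∎

  unload-A : ∀ u → Star Step (loaded u) (raiseB u (suc m' + m'))
  unload-A u = subst₂ (Star Step) (afterToppling-none (loaded u)) (unload-result u)
                 (burn (loaded u) inA burnable _ (λ _ → false) refl (λ _ ()) (legal-none (loaded u)))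
    where
    burnable : Burnable (loaded u) inA
    burnable T _ _ (k , inA∖T) = k , inA∖T , ≤-trans (loaded-≥deg u k) (m≤m+n _ _)

  FSC-free⇒recurrent : ∀ u → Stable u → FSC-free u → Recurrent u
  FSC-free⇒recurrent u stable fsc-free =
    stable , loaded u , loaded-≥deg u , (unload-A u ◅◅ drain u fsc-free (suc m' + m')) , stable

-- Sorted configurations u = a ++ b (a on A, b on B).  For them FSC-freeness is the
-- cross condition: for all i, j, a_i > j or b_j > i.  Recurrent ones with n·m' grains
-- are exactly the pairs (a, a*) with a* the conjugate of a.
module CrossCondition (m' n : ℕ) where
  open Sandpile (suc m') n
  open Bipartite m' n
  open DharCriterion m' n

  sorted-++ : ∀ a b → NonDecreasing a → NonDecreasing b → Sorted (a ++ b)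
  sorted-++ a b sorted-a sorted-b k k′ k≤k′ same-part with side k | side k′
  ... | inside-A i | inside-A i′ = subst₂ _≤_ (sym (lookup-++ˡ a b i)) (sym (lookup-++ˡ a b i′))
                                     (sorted-a i i′ (subst₂ _≤_ (toℕ-↑ˡ i n) (toℕ-↑ˡ i′ n) k≤k′))
  ... | inside-B j | inside-B j′ = subst₂ _≤_ (sym (lookup-++ʳ a b j)) (sym (lookup-++ʳ a b j′))
                                     (sorted-b j j′ (+-cancelˡ-≤ m' _ _ (subst₂ _≤_ (toℕ-↑ʳ m' j) (toℕ-↑ʳ m' j′) k≤k′)))
  ... | inside-A i | inside-B j′ = case trans (sym (inA-↑ˡ i)) (trans same-part (inA-↑ʳ j′)) of λ ()
  ... | inside-B j | inside-A i′ = case trans (sym (inA-↑ˡ i′)) (trans (sym same-part) (inA-↑ʳ j)) of λ ()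

  sorted-++⁻ : ∀ a b → Sorted (a ++ b) → NonDecreasing a × NonDecreasing b
  sorted-++⁻ a b sorted = sorted-a , sorted-b
    where
    sorted-a : NonDecreasing a
    sorted-a i i′ i≤i′ = subst₂ _≤_ (lookup-++ˡ a b i) (lookup-++ˡ a b i′)
      (sorted (i ↑ˡ n) (i′ ↑ˡ n) (subst₂ _≤_ (sym (toℕ-↑ˡ i n)) (sym (toℕ-↑ˡ i′ n)) i≤i′) (trans (inA-↑ˡ i) (sym (inA-↑ˡ i′))))
    sorted-b : NonDecreasing b
    sorted-b j j′ j≤j′ = subst₂ _≤_ (lookup-++ʳ a b j) (lookup-++ʳ a b j′)
      (sorted (m' ↑ʳ j) (m' ↑ʳ j′) (subst₂ _≤_ (sym (toℕ-↑ʳ m' j)) (sym (toℕ-↑ʳ m' j′)) (+-monoʳ-≤ m' j≤j′))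
              (trans (inA-↑ʳ j) (sym (inA-↑ʳ j′))))

  minimal⇔ : ∀ u → Minimal u ⇔ (Vec.sum u ≡ n * m')
  minimal⇔ u = mk⇔ (ℤ.+-injective ∘ ℤ.i-j≡0⇒i≡j _ _) (λ sum≡ → ℤ.i≡j⇒i-j≡0 (cong ℤ.+_ sum≡))

  Cross : Vec ℕ m' → Vec ℕ n → Set
  Cross a b = ∀ (i : Fin m') (j : Fin n) → suc (toℕ j) ≤ lookup a i ⊎ suc (toℕ i) ≤ lookup b j

  -- A nonempty F with α members in A and β in B: if α = 0 or β = 0 any member of F has no
  -- neighbour in F; otherwise F contains some i ≥ α - 1 in A and j ≥ β - 1 in B, and the
  -- cross condition for (i, j) gives a_i ≥ β or b_j ≥ α.
  cross⇒FSC-free : ∀ a b → Cross a b → FSC-free (a ++ b)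
  cross⇒FSC-free a b cross F (k , Fk) with count (onA F) in α | count (onB F) in β
  ... | zero | _ with side k
  ...   | inside-A i = ⊥-elim (<⇒≱ (count-member (onA F) i Fk) (≤-reflexive α))
  ...   | inside-B j = m' ↑ʳ j , Fk , subst (_≤ _) (sym (trans (neighboursIn-↑ʳ F j) α)) z≤n
  cross⇒FSC-free a b cross F (k , Fk) | suc _ | zero with side k
  ...   | inside-A i = i ↑ˡ n , Fk , subst (_≤ _) (sym (trans (neighboursIn-↑ˡ F i) β)) z≤n
  ...   | inside-B j = ⊥-elim (<⇒≱ (count-member (onB F) j Fk) (≤-reflexive β))
  cross⇒FSC-free a b cross F (k , Fk) | suc α′ | suc β′
    with count-beyond (onA F) α′ (subst (α′ <_) (sym α) ≤-refl) | count-beyond (onB F) β′ (subst (β′ <_) (sym β) ≤-refl)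
  ... | i , Fi , α′≤i | j , Fj , β′≤j with cross i j
  ...   | inj₁ j<aᵢ = i ↑ˡ n , Fi , subst₂ _≤_ (sym (trans (neighboursIn-↑ˡ F i) β)) (sym (lookup-++ˡ a b i)) (≤-trans (s≤s β′≤j) j<aᵢ)
  ...   | inj₂ i<bⱼ = m' ↑ʳ j , Fj , subst₂ _≤_ (sym (trans (neighboursIn-↑ʳ F j) α)) (sym (lookup-++ʳ a b j)) (≤-trans (s≤s α′≤i) i<bⱼ)

  corner : Fin m' → Fin n → V → Bool
  corner i j k = [ (λ i′ → toℕ i′ ≤ᵇ toℕ i) , (λ j′ → toℕ j′ ≤ᵇ toℕ j) ]′ (splitAt m' k)

  corner-↑ˡ : ∀ i j i′ → corner i j (i′ ↑ˡ n) ≡ (toℕ i′ ≤ᵇ toℕ i)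
  corner-↑ˡ i j i′ rewrite splitAt-↑ˡ m' i′ n = refl

  corner-↑ʳ : ∀ i j j′ → corner i j (m' ↑ʳ j′) ≡ (toℕ j′ ≤ᵇ toℕ j)
  corner-↑ʳ i j j′ rewrite splitAt-↑ʳ m' n j′ = refl

  corner-A-size : ∀ i j → suc (toℕ i) ≤ count (onA (corner i j))
  corner-A-size i j = count-initial _ (suc (toℕ i)) (toℕ<n i) (λ i′ i′≤i → trans (corner-↑ˡ i j i′) (≤ᵇ-complete (s≤s⁻¹ i′≤i)))

  corner-B-size : ∀ i j → suc (toℕ j) ≤ count (onB (corner i j))
  corner-B-size i j = count-initial _ (suc (toℕ j)) (toℕ<n j) (λ j′ j′≤j → trans (corner-↑ʳ i j j′) (≤ᵇ-complete (s≤s⁻¹ j′≤j)))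

  -- FSC-freeness applied to a corner: its good vertex is i′ ≤ i in A, having j+1
  -- neighbours in the corner, or j′ ≤ j in B, having i+1; sortedness transfers the bound.
  FSC-free⇒cross : ∀ a b → NonDecreasing a → NonDecreasing b → FSC-free (a ++ b) → Cross a b
  FSC-free⇒cross a b sorted-a sorted-b fsc-free i j
    with fsc-free (corner i j) (i ↑ˡ n , trans (corner-↑ˡ i j i) (≤ᵇ-complete (≤-refl {toℕ i})))
  ... | w , w∈corner , neighbours≤u with side w
  ...   | inside-A i′ = inj₁ (begin
    suc (toℕ j)                     ≤⟨ corner-B-size i j ⟩
    count (onB (corner i j))        ≡⟨ neighboursIn-↑ˡ (corner i j) i′ ⟨
    neighboursIn (corner i j) (i′ ↑ˡ n) ≤⟨ neighbours≤u ⟩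
    lookup (a ++ b) (i′ ↑ˡ n)       ≡⟨ lookup-++ˡ a b i′ ⟩
    lookup a i′                     ≤⟨ sorted-a i′ i (≤ᵇ-sound (trans (sym (corner-↑ˡ i j i′)) w∈corner)) ⟩
    lookup a i                      ∎)
    where open ≤-Reasoning
  ...   | inside-B j′ = inj₂ (begin
    suc (toℕ i)                     ≤⟨ corner-A-size i j ⟩
    count (onA (corner i j))        ≡⟨ neighboursIn-↑ʳ (corner i j) j′ ⟨
    neighboursIn (corner i j) (m' ↑ʳ j′) ≤⟨ neighbours≤u ⟩
    lookup (a ++ b) (m' ↑ʳ j′)      ≡⟨ lookup-++ʳ a b j′ ⟩
    lookup b j′                     ≤⟨ sorted-b j′ j (≤ᵇ-sound (trans (sym (corner-↑ʳ i j j′)) w∈corner)) ⟩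
    lookup b j                      ∎)
    where open ≤-Reasoning

  conjugate : Vec ℕ m' → Vec ℕ n
  conjugate a = tabulate λ j → count (λ i → lookup a i ≤ᵇ toℕ j)

  lookup-conjugate : ∀ a j → lookup (conjugate a) j ≡ count (λ i → lookup a i ≤ᵇ toℕ j)
  lookup-conjugate a j = lookup∘tabulate _ j

  -- Under the cross condition b dominates the conjugate: a_i ≤ j forces b_j > i.
  cross⇒conjugate-≤ : ∀ a b → Cross a b → ∀ j → lookup (conjugate a) j ≤ lookup b j
  cross⇒conjugate-≤ a b cross j = subst (_≤ lookup b j) (sym (lookup-conjugate a j)) (count-bounded _ (lookup b j) i<bⱼ)
    where
    i<bⱼ : ∀ i → (lookup a i ≤ᵇ toℕ j) ≡ true → toℕ i < lookup b j
    i<bⱼ i aᵢ≤j with cross i j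
    ... | inj₁ j<aᵢ = ⊥-elim (<⇒≱ j<aᵢ (≤ᵇ-sound aᵢ≤j))
    ... | inj₂ i<bⱼ = i<bⱼ

  -- If a is sorted and a_i ≤ j, then a_0..a_i ≤ j, so a*_j ≥ i + 1.
  cross-conjugate : ∀ a → NonDecreasing a → Cross a (conjugate a)
  cross-conjugate a sorted-a i j with suc (toℕ j) ≤? lookup a i
  ... | yes j<aᵢ = inj₁ j<aᵢ
  ... | no  j≮aᵢ = inj₂ (subst (suc (toℕ i) ≤_) (sym (lookup-conjugate a j))
      (count-initial _ (suc (toℕ i)) (toℕ<n i)
        (λ i′ i′≤i → ≤ᵇ-complete (≤-trans (sorted-a i′ i (s≤s⁻¹ i′≤i)) (s≤s⁻¹ (≰⇒> j≮aᵢ))))))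

  -- Σ a + Σ a* = m' · n: both sides count the pairs (i, j) in two ways.
  sum-conjugate : ∀ a → (∀ i → lookup a i ≤ n) → sum (lookup a) + sum (lookup (conjugate a)) ≡ m' * n
  sum-conjugate a a≤n = begin
    sum (lookup a) + sum (lookup (conjugate a))
      ≡⟨ cong (sum (lookup a) +_) (sum-cong-≗ (lookup-conjugate a)) ⟩
    sum (lookup a) + sum {n} (λ j → sum {m'} (λ i → indicator (lookup a i ≤ᵇ toℕ j)))
      ≡⟨ cong (sum (lookup a) +_) (∑-comm {m'} {n} (λ i j → indicator (lookup a i ≤ᵇ toℕ j))) ⟨
    sum (lookup a) + sum {m'} (λ i → count {n} (λ j → lookup a i ≤ᵇ toℕ j))
      ≡⟨ cong (sum (lookup a) +_) (sum-cong-≗ (λ i → count-≥ (lookup a i) (a≤n i))) ⟩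
    sum (lookup a) + sum (λ i → n ∸ lookup a i)
      ≡⟨ ∑-distrib-+ (lookup a) (λ i → n ∸ lookup a i) ⟨
    sum (λ i → lookup a i + (n ∸ lookup a i))
      ≡⟨ sum-cong-≗ (λ i → m+[n∸m]≡n (a≤n i)) ⟩
    sum {m'} (λ _ → n)
      ≡⟨ sum-const {m'} n ⟩
    m' * n ∎
    where open ≡-Reasoning

  conjugate-nonDecreasing : ∀ a → NonDecreasing (conjugate a)
  conjugate-nonDecreasing a j j′ j≤j′ = subst₂ _≤_ (sym (lookup-conjugate a j)) (sym (lookup-conjugate a j′))
    (count-mono {P = λ i → lookup a i ≤ᵇ toℕ j} {Q = λ i → lookup a i ≤ᵇ toℕ j′} below-j′)
    where
    below-j′ : ∀ i → (lookup a i ≤ᵇ toℕ j) ≡ true → (lookup a i ≤ᵇ toℕ j′) ≡ true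
    below-j′ i aᵢ≤j = ≤ᵇ-complete {lookup a i} (≤-trans (≤ᵇ-sound {lookup a i} aᵢ≤j) j≤j′)

  recurrent-conjugate : ∀ a → NonDecreasing a → (∀ i → lookup a i < n) → Recurrent (a ++ conjugate a)
  recurrent-conjugate a sorted-a a<n =
    FSC-free⇒recurrent (a ++ conjugate a) stable (cross⇒FSC-free a (conjugate a) (cross-conjugate a sorted-a))
    where
    stable : Stable (a ++ conjugate a)
    stable k with side k
    ... | inside-A i = subst₂ _<_ (sym (lookup-++ˡ a (conjugate a) i)) (sym (deg-↑ˡ i)) (a<n i)
    ... | inside-B j = subst₂ _<_ (sym (trans (lookup-++ʳ a (conjugate a) j) (lookup-conjugate a j))) (sym (deg-↑ʳ j))
                              (s≤s (count-≤ _))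

  sum-with-conjugate : ∀ a → (∀ i → lookup a i ≤ n) → Vec.sum (a ++ conjugate a) ≡ n * m'
  sum-with-conjugate a a≤n = trans (sum-vec-++ a (conjugate a)) (trans (sum-conjugate a a≤n) (*-comm m' n))

  -- A sorted recurrent configuration a ++ b with n·m' grains is (a, a*): b ≥ a* pointwise,
  -- and Σ a + Σ a* = n·m' leaves no room for a strict inequality.
  recurrent-minimal⇒conjugate : ∀ a b → NonDecreasing a → NonDecreasing b → Recurrent (a ++ b) →
                                Vec.sum (a ++ b) ≡ n * m' → b ≡ conjugate a
  recurrent-minimal⇒conjugate a b sorted-a sorted-b recurrent grains =
    lookup-ext (sum-mono-rigid (cross⇒conjugate-≤ a b cross) (≤-reflexive Σb≡Σa*))
    where
    cross = FSC-free⇒cross a b sorted-a sorted-b (recurrent⇒FSC-free (a ++ b) recurrent)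
    a≤n : ∀ i → lookup a i ≤ n
    a≤n i = <⇒≤ (subst₂ _<_ (lookup-++ˡ a b i) (deg-↑ˡ i) (proj₁ recurrent (i ↑ˡ n)))
    Σb≡Σa* : sum (lookup b) ≡ sum (lookup (conjugate a))
    Σb≡Σa* = +-cancelˡ-≡ (sum (lookup a)) _ _ (begin
      sum (lookup a) + sum (lookup b)                 ≡⟨ sum-vec-++ a b ⟨
      Vec.sum (a ++ b)                                ≡⟨ grains ⟩
      n * m'                                          ≡⟨ sum-with-conjugate a a≤n ⟨
      Vec.sum (a ++ conjugate a)                      ≡⟨ sum-vec-++ a (conjugate a) ⟩
      sum (lookup a) + sum (lookup (conjugate a))     ∎)
      where open ≡-Reasoning

module MinanzClassification (p q : ℕ) where
  open Sandpile (suc (suc p)) (suc (suc q))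
  open Bipartite (suc p) (suc (suc q))
  open DharCriterion (suc p) (suc (suc q))
  open CrossCondition (suc p) (suc (suc q))

  m' n : ℕ
  m' = suc p
  n  = suc (suc q)

  minanzConfig : Vec ℕ p → Config
  minanzConfig t = (1 ∷ t) ++ conjugate (1 ∷ t)

  -- v_{m+1} (position m' ↑ʳ 1) is not v_m, so almost non-zero requires a*_1 > 0.
  second-of-B≢m : ¬ suc (toℕ (m' ↑ʳ Fin.suc {suc q} zero)) ≡ suc m'
  second-of-B≢m e = m+1+n≢m m' (trans (sym (toℕ-↑ʳ m' (Fin.suc zero))) (suc-injective e))

  -- a*_1 > 0 means some a_i ≤ 1, so a_0 ≤ 1; and a_0 > 0.
  leading-one : ∀ a → NonDecreasing a → AlmostNonZero (a ++ conjugate a) → lookup a zero ≡ 1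
  leading-one a sorted-a almostNonZero with count-witness (λ i → lookup a i ≤ᵇ 1) a*₁>0
    where
    a*₁>0 : 0 < count (λ i → lookup a i ≤ᵇ 1)
    a*₁>0 = subst (0 <_) (trans (lookup-++ʳ a (conjugate a) (Fin.suc zero)) (lookup-conjugate a (Fin.suc zero)))
                  (almostNonZero (m' ↑ʳ Fin.suc zero) second-of-B≢m)
  ... | i , aᵢ≤1 = ≤-antisym (≤-trans (sorted-a zero i z≤n) (≤ᵇ-sound {lookup a i} aᵢ≤1))
                             (subst (0 <_) (lookup-++ˡ a (conjugate a) zero) (almostNonZero (zero ↑ˡ n) (λ ())))

  -- (1 ∷ t, (1 ∷ t)*) is a conjugate pair, hence sorted, recurrent and of level 0; its
  -- entries are ≥ 1 on A, and a*_j ≥ 1 for j ≥ 1 because a_0 = 1.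
  minanzConfig-minanz : ∀ t → Ascending 1 n t → RecStar (minanzConfig t) × Minanz (minanzConfig t)
  minanzConfig-minanz t ascending-t =
    (recurrent-conjugate a sorted-a (ascending-< ascending-a) , sorted-++ a (conjugate a) sorted-a (conjugate-nonDecreasing a)) ,
    Equivalence.from (minimal⇔ (minanzConfig t)) (sum-with-conjugate a (<⇒≤ ∘ ascending-< ascending-a)) ,
    almostNonZero
    where
    a = 1 ∷ t
    ascending-a : Ascending 1 n a
    ascending-a = (≤-refl , s≤s (s≤s z≤n)) ∷ ascending-t
    sorted-a = ascending-nonDecreasing ascending-a
    almostNonZero : AlmostNonZero (minanzConfig t)
    almostNonZero k k≢m with side k
    ... | inside-A i         = subst (0 <_) (sym (lookup-++ˡ a (conjugate a) i)) (ascending-≥ ascending-a i)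
    ... | inside-B zero      = ⊥-elim (k≢m (cong suc (trans (toℕ-↑ʳ m' zero) (+-identityʳ m'))))
    ... | inside-B (suc j)   = subst (0 <_) (sym (trans (lookup-++ʳ a (conjugate a) (suc j)) (lookup-conjugate a (suc j))))
                                     (count-member (λ i → lookup a i ≤ᵇ toℕ (Fin.suc j)) zero refl)

  -- Conversely, writing u = a ++ b: b = a* by minimality, then a_0 = 1, and the
  -- remaining entries of a are in [1, n) by sortedness and stability.
  minanz⇒minanzConfig : ∀ u → RecStar u × Minanz u → ∃ λ t → Ascending 1 n t × u ≡ minanzConfig t
  minanz⇒minanzConfig u ((recurrent , sorted) , minimal , almostNonZero) with Vec.splitAt m' u
  ... | a₀ ∷ t , b , refl =
    t , ascending-t , cong₂ (λ x y → (x ∷ t) ++ y) a₀≡1 (trans b≡a* (cong (λ x → conjugate (x ∷ t)) a₀≡1))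
    where
    a = a₀ ∷ t
    sorted-a = proj₁ (sorted-++⁻ a b sorted)
    b≡a* : b ≡ conjugate a
    b≡a* = recurrent-minimal⇒conjugate a b sorted-a (proj₂ (sorted-++⁻ a b sorted)) recurrent
             (Equivalence.to (minimal⇔ (a ++ b)) minimal)
    a₀≡1 : a₀ ≡ 1
    a₀≡1 = leading-one a sorted-a (subst (λ b → AlmostNonZero (a ++ b)) b≡a* almostNonZero)
    ascending-t : Ascending 1 n t
    ascending-t = nonDecreasing⇒ascending 1 n t
      (λ i → subst (_≤ lookup t i) a₀≡1 (sorted-a zero (suc i) z≤n))
      (λ i → subst₂ _<_ (lookup-++ˡ a b (suc i)) (deg-↑ˡ (suc i)) (proj₁ recurrent (suc i ↑ˡ n)))
      (λ i i′ i≤i′ → sorted-a (suc i) (suc i′) (s≤s i≤i′))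

  minanzList : List Config
  minanzList = List.map minanzConfig (ascending p 1 (suc q))

  minanzList-unique : Unique minanzList
  minanzList-unique = Unique.map⁺ minanzConfig-injective (ascending-unique p 1 (suc q))
    where
    minanzConfig-injective : ∀ {t t′} → minanzConfig t ≡ minanzConfig t′ → t ≡ t′
    minanzConfig-injective {t} {t′} e = ∷-injectiveʳ (Vec.++-injectiveˡ (1 ∷ t) (1 ∷ t′) e)

  minanzList-members : ∀ u → (u ∈ minanzList) ⇔ (RecStar u × Minanz u)
  minanzList-members u = mk⇔ member⇒minanz minanz⇒member
    where
    member⇒minanz : u ∈ minanzList → RecStar u × Minanz u
    member⇒minanz u∈ with ∈-map⁻ minanzConfig u∈
    ... | t , t∈ , refl = minanzConfig-minanz t (ascending-sound p 1 (suc q) t∈)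
    minanz⇒member : RecStar u × Minanz u → u ∈ minanzList
    minanz⇒member minanz with minanz⇒minanzConfig u minanz
    ... | t , ascending-t , refl = ∈-map⁺ minanzConfig (ascending-complete p 1 (suc q) ascending-t)

  minanzList-length : length minanzList ≡ (p + q) C p
  minanzList-length = trans (length-map minanzConfig (ascending p 1 (suc q))) (ascending-length p 1 q)

mainTheorem8 : (m n : ℕ) → 2 ≤ m → 2 ≤ n →
    Σ (List (Sandpile.Config m n)) λ us →
    Unique us
    × (∀ u → (u ∈ us) ⇔ (Sandpile.RecStar m n u × Sandpile.Minanz m n u))
    × length us ≡ (m + n ∸ 4) C (m ∸ 2)
mainTheorem8 (suc (suc p)) (suc (suc q)) (s≤s (s≤s z≤n)) (s≤s (s≤s z≤n)) =
  minanzList , minanzList-unique , minanzList-members , trans minanzList-length (cong (_C p) p+q≡m+n∸4)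
  where
  open MinanzClassification p q
  p+q≡m+n∸4 : p + q ≡ p + suc (suc q) ∸ 2
  p+q≡m+n∸4 = cong (_∸ 2) (sym (trans (+-suc p (suc q)) (cong suc (+-suc p q))))
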